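{- Let $m\ge0$ be an integer and let $s_n$ be defined by $s_n=\delta_{n,0}+s_{n-1}+s_{n-m-2}$ for $n\ge0$ and $s_n=0$ for $n<0$. Then for all $n\ge0$, \[ s_{n+m+2}^2-1=\sum_{k=0}^n\left\{s_{k}^2+2\sum_{i=0}^kP_{k+m+1-i}^{\{ -2,-1,m\}}s_{i}^2\right\}. \]
   Context: $\delta_{i,j}$ is $1$ if $i=j$ and $0$ otherwise. For a finite set $W$ of integers, $P_n^W$ is the number of permutations $\pi$ of $\{1,\ldots,n\}$ with $\pi(i)-i\in W$ for all $i$ (equivalently, the permanent of the $n\times n$ $(0,1)$ matrix whose $(i,j)$ entry is $1$ iff $j-i\in W$), with $P_0^W=1$. -}

module Defs where

open import Data.Nat using (ℕ; zero; suc; _+_; _*_; _∸_; _≤?_)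
open import Data.Integer as ℤ using (ℤ)
open import Data.List using (List; []; _∷_; concatMap; map; length; filterᵇ; upTo; zip; foldr)
open import Data.Bool.ListAction using (all; any)
open import Data.Fin using (Fin; toℕ)
open import Data.Fin as F using ()
open import Data.List using (allFin)
open import Data.Product using (_×_; _,_)
open import Data.Bool using (Bool; if_then_else_)
open import Relation.Nullary.Decidable using (⌊_⌋)

insertions : {A : Set} → A → List A → List (List A)
insertions x []       = (x ∷ []) ∷ []
insertions x (y ∷ ys) = (x ∷ y ∷ ys) ∷ map (y ∷_) (insertions x ys)

perms : {A : Set} → List A → List (List A)
perms []       = [] ∷ []
perms (x ∷ xs) = concatMap (insertions x) (perms xs)

-- a permutation π of {0,…,n-1} given as the word [π(0), …, π(n-1)];
-- it is admissible for W when π(i) - i ∈ W for every i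
admissible : List ℤ → (n : ℕ) → List (Fin n) → Bool
admissible W n w =
  all (λ { (i , v) → any (λ d → ⌊ (ℤ.+ toℕ v) ℤ.- (ℤ.+ i) ℤ.≟ d ⌋) W })
      (zip (upTo n) w)

-- P_n^W : number of permutations π of {1..n} (equivalently {0..n-1})
-- with π(i) - i ∈ W for all i ;  P_0^W = 1
P : List ℤ → ℕ → ℕ
P W n = length (filterᵇ (admissible W n) (perms (allFin n)))

-- s_n (for n ≥ 0) with s_0 = 1, s_{n} = s_{n-1} + s_{n-m-2} (s_j = 0 for j<0).
-- sAux m f n computes s_n using fuel f ≥ n.
sAux : ℕ → ℕ → ℕ → ℕ
sAux m f       zero    = 1
sAux m zero    (suc k) = 0
sAux m (suc f) (suc k) =
  sAux m f k + (if ⌊ suc m Data.Nat.≤? k ⌋ then sAux m f (k ∸ suc m) else 0)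

s : ℕ → ℕ → ℕ
s m n = sAux m n n

Σ≤ : ℕ → (ℕ → ℤ) → ℤ
Σ≤ n f = foldr ℤ._+_ (ℤ.+ 0) (map f (upTo (suc n)))

{-# OPTIONS --safe #-}
-- Since s_{n+m+2} = s_{n+m+1} + s_n and s_{m+1} = 1, squaring and telescoping reduce the identity
-- to s_k s_{k+m+1} = Σ_{i≤k} P_{k+m+1-i} s_i².  This is the case e = m of
-- s_c s_{c+e+1} = Σ_{j≤c} b_e(c-j) s_j² (0 ≤ e ≤ m), proved by strong induction on c: in
-- s_{c+e+1} = s_{c+e} + s_{c+e-m-1} the second product s_c s_{c-(m-e+1)} has the same shape with e
-- replaced by m - e, so b_e = b_{e-1} + (b_{m-e} shifted by m-e+1), where b_{-1} = δ_0.
-- The permanent P_n^{-2,-1,m} is counted position by position: before position q all values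
-- below q - 2 and exactly two values ≥ q - 2 are used, and an unused value q - 2 must be placed at q.
-- The resulting transfer recursion obeys the recurrence of b_m, which gives P_{r+m+1} = b_m(r).
module Submission where

open import Defs
open import Algebra.Properties.CommutativeSemigroup using (interchange)
open import Data.Bool using (Bool; true; false; not; _∧_; _∨_; if_then_else_; T)
open import Data.Bool.ListAction using (all; any)
open import Data.Bool.Properties using (∧-zeroʳ; ∧-identityʳ; ∨-identityʳ)
open import Data.Empty using (⊥-elim)
open import Data.Fin using (Fin; toℕ)
open import Data.Integer as ℤ using (ℤ; -[1+_]; _⊖_)
open import Data.Integer.Properties as ℤₚ using ([1+m]⊖[1+n]≡m⊖n; [+m]-[+n]≡m⊖n)
open import Data.List using (List; []; _∷_; _++_; map; concatMap; filterᵇ; length; upTo; applyUpTo; allFin; tabulate; zip; foldr)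
open import Data.List.Membership.Propositional using (_∈_)
open import Data.List.Membership.Propositional.Properties using (∈-filter⁺; ∈-upTo⁺)
open import Data.List.Properties using (upTo-∷ʳ; map-∘; map-tabulate; concatMap-map; concatMap-cong; map-concatMap; length-tabulate; map-cong-local)
open import Data.List.Relation.Unary.All as All using (All; []; _∷_)
open import Data.List.Relation.Unary.All.Properties using (applyUpTo⁺₁; map⁺; concat⁺)
open import Data.List.Relation.Unary.AllPairs using ([]; _∷_)
open import Data.List.Relation.Unary.Any using (here; there)
open import Data.List.Relation.Unary.Unique.Propositional using (Unique)
open import Data.List.Relation.Unary.Unique.Propositional.Properties using (upTo⁺; filter⁺)
open import Data.Nat as ℕ using (ℕ; zero; suc; _+_; _∸_; _≟_; _<_; _≤_; _<?_; _≤?_; z≤n; s≤s)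
open import Data.Nat.Induction using (<-rec)
open import Data.Nat.Properties
open import Data.Nat.Tactic.RingSolver using (solve-∀)
open import Data.Product using (Σ; _×_; _,_)
open import Data.Unit using (tt)
open import Function using (_∘_; id)
open import Function.Bundles using (mk⇔)
open import Relation.Binary using (tri<; tri≈; tri>)
open import Relation.Binary.PropositionalEquality
open import Relation.Nullary using (Dec; yes; no; ¬_)
open import Relation.Nullary.Decidable using (⌊_⌋; T?; isYes≗does; does-⇔)
open ≡-Reasoning

⌊⌋-⇔ : {A B : Set} → (A → B) → (B → A) → (a? : Dec A) (b? : Dec B) → ⌊ a? ⌋ ≡ ⌊ b? ⌋
⌊⌋-⇔ f g a? b? = trans (isYes≗does a?) (trans (does-⇔ (mk⇔ f g) a? b?) (sym (isYes≗does b?)))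

⌊⌋-yes : {A : Set} (a? : Dec A) → A → ⌊ a? ⌋ ≡ true
⌊⌋-yes (yes _) _ = refl
⌊⌋-yes (no ¬a) a = ⊥-elim (¬a a)

⌊⌋-no : {A : Set} (a? : Dec A) → ¬ A → ⌊ a? ⌋ ≡ false
⌊⌋-no (yes a) ¬a = ⊥-elim (¬a a)
⌊⌋-no (no _)  _  = refl

if-⌊yes⌋ : {A : Set} (a? : Dec A) → A → (x y : ℕ) → (if ⌊ a? ⌋ then x else y) ≡ x
if-⌊yes⌋ a? a x y = cong (if_then x else y) (⌊⌋-yes a? a)

if-⌊no⌋ : {A : Set} (a? : Dec A) → ¬ A → (x y : ℕ) → (if ⌊ a? ⌋ then x else y) ≡ y
if-⌊no⌋ a? ¬a x y = cong (if_then x else y) (⌊⌋-no a? ¬a)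

if-same : (b : Bool) (x : ℕ) → (if b then x else x) ≡ x
if-same true  x = refl
if-same false x = refl

suc-≟ : ∀ a b → ⌊ suc a ≟ suc b ⌋ ≡ ⌊ a ≟ b ⌋
suc-≟ a b = ⌊⌋-⇔ suc-injective (cong suc) (suc a ≟ suc b) (a ≟ b)

if-⌊⌋-cong : {A B : Set} (a? : Dec A) (b? : Dec B) → (A → B) → (B → A) → {x y : ℕ} → (A → x ≡ y) →
             (if ⌊ a? ⌋ then x else 0) ≡ (if ⌊ b? ⌋ then y else 0)
if-⌊⌋-cong (yes a) (yes b) A⇒B B⇒A x≡y = x≡y a
if-⌊⌋-cong (yes a) (no ¬b) A⇒B B⇒A x≡y = ⊥-elim (¬b (A⇒B a))
if-⌊⌋-cong (no ¬a) (yes b) A⇒B B⇒A x≡y = ⊥-elim (¬a (B⇒A b))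
if-⌊⌋-cong (no ¬a) (no ¬b) A⇒B B⇒A x≡y = refl

sumBy : {A : Set} → (A → ℕ) → List A → ℕ
sumBy f []       = 0
sumBy f (x ∷ xs) = f x + sumBy f xs

indicator : {A : Set} → (A → Bool) → A → ℕ
indicator p x = if p x then 1 else 0

module _ {A : Set} where

  sumBy-++ : (f : A → ℕ) (xs ys : List A) → sumBy f (xs ++ ys) ≡ sumBy f xs + sumBy f ys
  sumBy-++ f []       ys = refl
  sumBy-++ f (x ∷ xs) ys = trans (cong (f x +_) (sumBy-++ f xs ys)) (sym (+-assoc (f x) _ _))

  sumBy-congᴬ : {f g : A → ℕ} {xs : List A} → All (λ x → f x ≡ g x) xs → sumBy f xs ≡ sumBy g xs
  sumBy-congᴬ []       = refl
  sumBy-congᴬ (p ∷ ps) = cong₂ _+_ p (sumBy-congᴬ ps)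

  sumBy-cong : {f g : A → ℕ} → (∀ x → f x ≡ g x) → (xs : List A) → sumBy f xs ≡ sumBy g xs
  sumBy-cong f≗g xs = sumBy-congᴬ (All.universal f≗g xs)

  sumBy-+ : (f g : A → ℕ) (xs : List A) → sumBy (λ x → f x + g x) xs ≡ sumBy f xs + sumBy g xs
  sumBy-+ f g []       = refl
  sumBy-+ f g (x ∷ xs) = trans (cong (f x + g x +_) (sumBy-+ f g xs))
                               (interchange +-commutativeSemigroup (f x) (g x) _ _)

  sumBy-zero : (xs : List A) → sumBy (λ _ → 0) xs ≡ 0
  sumBy-zero []       = refl
  sumBy-zero (x ∷ xs) = sumBy-zero xs

  sumBy-filterᵇ : (f : A → ℕ) (p : A → Bool) (xs : List A) →
                  sumBy f (filterᵇ p xs) ≡ sumBy (λ x → if p x then f x else 0) xs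
  sumBy-filterᵇ f p []       = refl
  sumBy-filterᵇ f p (x ∷ xs) with p x
  ... | true  = cong (f x +_) (sumBy-filterᵇ f p xs)
  ... | false = sumBy-filterᵇ f p xs

  length-filterᵇ : (p : A → Bool) (xs : List A) → length (filterᵇ p xs) ≡ sumBy (indicator p) xs
  length-filterᵇ p []       = refl
  length-filterᵇ p (x ∷ xs) with p x
  ... | true  = cong suc (length-filterᵇ p xs)
  ... | false = length-filterᵇ p xs

  filterᵇ-filterᵇ : (p q : A → Bool) (xs : List A) → filterᵇ p (filterᵇ q xs) ≡ filterᵇ (λ x → q x ∧ p x) xs
  filterᵇ-filterᵇ p q []       = refl
  filterᵇ-filterᵇ p q (x ∷ xs) with q x
  ... | false = filterᵇ-filterᵇ p q xs
  ... | true with p x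
  ...   | true  = cong (x ∷_) (filterᵇ-filterᵇ p q xs)
  ...   | false = filterᵇ-filterᵇ p q xs

  filterᵇ-cong : {p q : A → Bool} → (∀ x → p x ≡ q x) → (xs : List A) → filterᵇ p xs ≡ filterᵇ q xs
  filterᵇ-cong {p} {q} p≗q []       = refl
  filterᵇ-cong {p} {q} p≗q (x ∷ xs) with p x | q x | p≗q x
  ... | true  | .true  | refl = cong (x ∷_) (filterᵇ-cong p≗q xs)
  ... | false | .false | refl = filterᵇ-cong p≗q xs

  filterᵇ-none : {p : A → Bool} {xs : List A} → All (λ x → p x ≡ false) xs → filterᵇ p xs ≡ []
  filterᵇ-none {p} {[]}     []         = refl
  filterᵇ-none {p} {x ∷ xs} (px ∷ pxs) rewrite px = filterᵇ-none pxs

  filterᵇ-all : {p : A → Bool} → (∀ x → p x ≡ true) → (xs : List A) → filterᵇ p xs ≡ xs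
  filterᵇ-all {p} p≡true []       = refl
  filterᵇ-all {p} p≡true (x ∷ xs) rewrite p≡true x = cong (x ∷_) (filterᵇ-all p≡true xs)

module _ {A B : Set} where

  sumBy-map : (f : B → ℕ) (g : A → B) (xs : List A) → sumBy f (map g xs) ≡ sumBy (f ∘ g) xs
  sumBy-map f g []       = refl
  sumBy-map f g (x ∷ xs) = cong (f (g x) +_) (sumBy-map f g xs)

  sumBy-concatMap : (f : B → ℕ) (g : A → List B) (xs : List A) →
                    sumBy f (concatMap g xs) ≡ sumBy (sumBy f ∘ g) xs
  sumBy-concatMap f g []       = refl
  sumBy-concatMap f g (x ∷ xs) =
    trans (sumBy-++ f (g x) (concatMap g xs)) (cong (sumBy f (g x) +_) (sumBy-concatMap f g xs))

sumBy-upTo-suc : (f : ℕ → ℕ) (k : ℕ) → sumBy f (upTo (suc k)) ≡ sumBy f (upTo k) + f k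
sumBy-upTo-suc f k = begin
  sumBy f (upTo (suc k))          ≡⟨ cong (sumBy f) (sym (upTo-∷ʳ k)) ⟩
  sumBy f (upTo k ++ k ∷ [])      ≡⟨ sumBy-++ f (upTo k) (k ∷ []) ⟩
  sumBy f (upTo k) + (f k + 0)    ≡⟨ cong (sumBy f (upTo k) +_) (+-identityʳ (f k)) ⟩
  sumBy f (upTo k) + f k          ∎

sumBy-upTo-≟ : (k a : ℕ) (g : ℕ → ℕ) →
               sumBy (λ y → if ⌊ y ≟ a ⌋ then g y else 0) (upTo k) ≡ (if ⌊ a <? k ⌋ then g a else 0)
sumBy-upTo-≟ zero    a g = refl
sumBy-upTo-≟ (suc k) a g = begin
  sumBy f (upTo (suc k))                       ≡⟨ sumBy-upTo-suc f k ⟩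
  sumBy f (upTo k) + f k                       ≡⟨ cong (_+ f k) (sumBy-upTo-≟ k a g) ⟩
  (if ⌊ a <? k ⌋ then g a else 0) + f k        ≡⟨ last (<-cmp a k) ⟩
  (if ⌊ a <? suc k ⌋ then g a else 0)          ∎
  where
  f : ℕ → ℕ
  f y = if ⌊ y ≟ a ⌋ then g y else 0
  last : _ → (if ⌊ a <? k ⌋ then g a else 0) + f k ≡ (if ⌊ a <? suc k ⌋ then g a else 0)
  last (tri< a<k a≢k _) rewrite if-⌊yes⌋ (a <? k) a<k (g a) 0 | if-⌊no⌋ (k ≟ a) (a≢k ∘ sym) (g k) 0
                              | if-⌊yes⌋ (a <? suc k) (m<n⇒m<1+n a<k) (g a) 0 = +-identityʳ (g a)
  last (tri≈ a≮k refl _) rewrite if-⌊no⌋ (a <? a) a≮k (g a) 0 | if-⌊yes⌋ (a ≟ a) refl (g a) 0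
                              | if-⌊yes⌋ (a <? suc a) ≤-refl (g a) 0 = refl
  last (tri> a≮k a≢k k<a) rewrite if-⌊no⌋ (a <? k) a≮k (g a) 0 | if-⌊no⌋ (k ≟ a) (a≢k ∘ sym) (g k) 0
                              | if-⌊no⌋ (a <? suc k) (<⇒≱ k<a ∘ ≤-pred) (g a) 0 = refl

sumTo : ℕ → (ℕ → ℕ) → ℕ
sumTo c f = sumBy f (upTo (suc c))

sumTo-suc : (c : ℕ) (f : ℕ → ℕ) → sumTo (suc c) f ≡ sumTo c f + f (suc c)
sumTo-suc c = λ f → sumBy-upTo-suc f (suc c)

sumTo-cong : (c : ℕ) {f g : ℕ → ℕ} → (∀ j → j ≤ c → f j ≡ g j) → sumTo c f ≡ sumTo c g
sumTo-cong c f≗g = sumBy-congᴬ (applyUpTo⁺₁ id (suc c) (λ j<1+c → f≗g _ (≤-pred j<1+c)))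

sumTo-zero : (c : ℕ) {f : ℕ → ℕ} → (∀ j → j ≤ c → f j ≡ 0) → sumTo c f ≡ 0
sumTo-zero c f≗0 = trans (sumTo-cong c f≗0) (sumBy-zero (upTo (suc c)))

sumTo-extend : (c d : ℕ) (f : ℕ → ℕ) → (∀ j → c < j → j ≤ c + d → f j ≡ 0) → sumTo (c + d) f ≡ sumTo c f
sumTo-extend c zero    f f≡0 = cong (λ x → sumTo x f) (+-identityʳ c)
sumTo-extend c (suc d) f f≡0 = begin
  sumTo (c + suc d) f              ≡⟨ cong (λ x → sumTo x f) (+-suc c d) ⟩
  sumTo (suc (c + d)) f            ≡⟨ sumTo-suc (c + d) f ⟩
  sumTo (c + d) f + f (suc (c + d)) ≡⟨ cong₂ _+_ (sumTo-extend c d f (λ j c<j j≤c+d → f≡0 j c<j (≤-trans j≤c+d (+-monoʳ-≤ c (n≤1+n d)))))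
                                                (f≡0 _ (s≤s (m≤m+n c d)) (≤-reflexive (sym (+-suc c d)))) ⟩
  sumTo c f + 0                    ≡⟨ +-identityʳ _ ⟩
  sumTo c f                        ∎

sumTo-last : (c : ℕ) {f : ℕ → ℕ} → (∀ j → j < c → f j ≡ 0) → sumTo c f ≡ f c
sumTo-last zero    {f} _    = +-identityʳ (f 0)
sumTo-last (suc c) {f} f≡0 = trans (sumTo-suc c f) (cong (_+ f (suc c)) (sumTo-zero c (λ j j≤c → f≡0 j (s≤s j≤c))))

module _ {A : Set} where

  select : List A → List (A × List A)
  select []       = []
  select (x ∷ xs) = (x , xs) ∷ map (λ { (y , ys) → y , x ∷ ys }) (select xs)

  sumByFirst : (List A → ℕ) → A × List A → ℕ
  sumByFirst h (y , ys) = sumBy (h ∘ (y ∷_)) (perms ys)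

  sumBy-perms-∷ : (x : A) (xs : List A) (h : List A → ℕ) →
                  sumBy h (perms (x ∷ xs)) ≡ sumBy (sumByFirst h) (select (x ∷ xs))
  sumBy-perms-∷ x []       h = sym (+-identityʳ (h (x ∷ []) + 0))
  sumBy-perms-∷ x (z ∷ zs) h = begin
    sumBy h (concatMap (insertions x) (perms (z ∷ zs)))
      ≡⟨ sumBy-concatMap h (insertions x) (perms (z ∷ zs)) ⟩
    sumBy hᵢ (perms (z ∷ zs))
      ≡⟨ sumBy-perms-∷ z zs hᵢ ⟩
    sumBy (sumByFirst hᵢ) (select (z ∷ zs))
      ≡⟨ sumBy-cong split (select (z ∷ zs)) ⟩
    sumBy (λ e → sumByFirst (h ∘ (x ∷_)) e + sumByFirst h (prepend e)) (select (z ∷ zs))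
      ≡⟨ sumBy-+ (sumByFirst (h ∘ (x ∷_))) (sumByFirst h ∘ prepend) (select (z ∷ zs)) ⟩
    sumBy (sumByFirst (h ∘ (x ∷_))) (select (z ∷ zs)) + sumBy (sumByFirst h ∘ prepend) (select (z ∷ zs))
      ≡⟨ cong₂ _+_ (sym (sumBy-perms-∷ z zs (h ∘ (x ∷_))))
                   (sym (sumBy-map (sumByFirst h) prepend (select (z ∷ zs)))) ⟩
    sumByFirst h (x , z ∷ zs) + sumBy (sumByFirst h) (map prepend (select (z ∷ zs))) ∎
    where
    hᵢ : List A → ℕ
    hᵢ w = sumBy h (insertions x w)
    prepend : A × List A → A × List A
    prepend (y , ys) = y , x ∷ ys
    split : ∀ e → sumByFirst hᵢ e ≡ sumByFirst (h ∘ (x ∷_)) e + sumByFirst h (prepend e)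
    split (y , ys) = begin
      sumBy (λ w → h (x ∷ y ∷ w) + sumBy h (map (y ∷_) (insertions x w))) (perms ys)
        ≡⟨ sumBy-cong (λ w → cong (h (x ∷ y ∷ w) +_) (sumBy-map h (y ∷_) (insertions x w))) (perms ys) ⟩
      sumBy (λ w → h (x ∷ y ∷ w) + sumBy (h ∘ (y ∷_)) (insertions x w)) (perms ys)
        ≡⟨ sumBy-+ _ _ (perms ys) ⟩
      sumBy (λ w → h (x ∷ y ∷ w)) (perms ys) + sumBy (λ w → sumBy (h ∘ (y ∷_)) (insertions x w)) (perms ys)
        ≡⟨ cong (sumBy (λ w → h (x ∷ y ∷ w)) (perms ys) +_)
                (sym (sumBy-concatMap (h ∘ (y ∷_)) (insertions x) (perms ys))) ⟩
      sumBy (λ w → h (x ∷ y ∷ w)) (perms ys) + sumBy (h ∘ (y ∷_)) (perms (x ∷ ys)) ∎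

remove : ℕ → List ℕ → List ℕ
remove y = filterᵇ (λ v → not ⌊ v ≟ y ⌋)

remove-∉ : ∀ y xs → All (λ v → ¬ y ≡ v) xs → remove y xs ≡ xs
remove-∉ y []       []         = refl
remove-∉ y (x ∷ xs) (y≢x ∷ ps) with x ≟ y
... | yes x≡y = ⊥-elim (y≢x (sym x≡y))
... | no  _   = cong (x ∷_) (remove-∉ y xs ps)

remove-head : ∀ y xs → All (λ v → ¬ y ≡ v) xs → remove y (y ∷ xs) ≡ xs
remove-head y xs ps with y ≟ y
... | yes _   = remove-∉ y xs ps
... | no  y≢y = ⊥-elim (y≢y refl)

remove-∷ : ∀ x y xs → ¬ x ≡ y → remove y (x ∷ xs) ≡ x ∷ remove y xs
remove-∷ x y xs x≢y with x ≟ y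
... | yes x≡y = ⊥-elim (x≢y x≡y)
... | no  _   = refl

sumBy-select : (xs : List ℕ) → Unique xs → (F : ℕ × List ℕ → ℕ) →
               sumBy F (select xs) ≡ sumBy (λ y → F (y , remove y xs)) xs
sumBy-select []       []           F = refl
sumBy-select (x ∷ xs) (x∉xs ∷ u) F = cong₂ _+_ (cong (λ r → F (x , r)) (sym (remove-head x xs x∉xs))) (begin
  sumBy F (map prepend (select xs))          ≡⟨ sumBy-map F prepend (select xs) ⟩
  sumBy (F ∘ prepend) (select xs)            ≡⟨ sumBy-select xs u (F ∘ prepend) ⟩
  sumBy (λ y → F (y , x ∷ remove y xs)) xs   ≡⟨ sumBy-congᴬ (All.map (λ x≢y → cong (λ r → F (_ , r)) (sym (remove-∷ x _ xs x≢y))) x∉xs) ⟩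
  sumBy (λ y → F (y , remove y (x ∷ xs))) xs ∎)
  where
  prepend : ℕ × List ℕ → ℕ × List ℕ
  prepend (y , ys) = y , x ∷ ys

sumBy-perms-unique : (h : List ℕ → ℕ) (xs : List ℕ) → Unique xs → ¬ xs ≡ [] →
                     sumBy h (perms xs) ≡ sumBy (λ y → sumBy (h ∘ (y ∷_)) (perms (remove y xs))) xs
sumBy-perms-unique h []       u xs≢[] = ⊥-elim (xs≢[] refl)
sumBy-perms-unique h (x ∷ xs) u xs≢[] =
  trans (sumBy-perms-∷ x xs h) (sumBy-select (x ∷ xs) u (sumByFirst h))

module _ {A B : Set} (f : A → B) where

  insertions-map : ∀ x w → insertions (f x) (map f w) ≡ map (map f) (insertions x w)
  insertions-map x []       = refl
  insertions-map x (y ∷ ys) = cong ((f x ∷ f y ∷ map f ys) ∷_) (begin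
    map (f y ∷_) (insertions (f x) (map f ys))     ≡⟨ cong (map (f y ∷_)) (insertions-map x ys) ⟩
    map (f y ∷_) (map (map f) (insertions x ys))   ≡⟨ sym (map-∘ (insertions x ys)) ⟩
    map (map f ∘ (y ∷_)) (insertions x ys)         ≡⟨ map-∘ (insertions x ys) ⟩
    map (map f) (map (y ∷_) (insertions x ys))     ∎)

  perms-map : ∀ xs → perms (map f xs) ≡ map (map f) (perms xs)
  perms-map []       = refl
  perms-map (x ∷ xs) = begin
    concatMap (insertions (f x)) (perms (map f xs))         ≡⟨ cong (concatMap (insertions (f x))) (perms-map xs) ⟩
    concatMap (insertions (f x)) (map (map f) (perms xs))   ≡⟨ concatMap-map (insertions (f x)) (map f) (perms xs) ⟩
    concatMap (insertions (f x) ∘ map f) (perms xs)         ≡⟨ concatMap-cong (insertions-map x) (perms xs) ⟩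
    concatMap (map (map f) ∘ insertions x) (perms xs)       ≡⟨ sym (map-concatMap (map f) (insertions x) (perms xs)) ⟩
    map (map f) (concatMap (insertions x) (perms xs))       ∎

module _ {A : Set} where

  length-insertions : (x : A) (w : List A) → All (λ u → length u ≡ suc (length w)) (insertions x w)
  length-insertions x []       = refl ∷ []
  length-insertions x (y ∷ ys) = refl ∷ map⁺ (All.map (cong suc) (length-insertions x ys))

  length-perms : (xs : List A) → All (λ w → length w ≡ length xs) (perms xs)
  length-perms []       = refl ∷ []
  length-perms (x ∷ xs) = concat⁺ (map⁺ (All.map ins (length-perms xs)))
    where
    ins : ∀ {w} → length w ≡ length xs → All (λ u → length u ≡ suc (length xs)) (insertions x w)
    ins {w} len = subst (λ k → All (λ u → length u ≡ suc k) (insertions x w)) len (length-insertions x w)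

  ∈-insertions-new : (x : A) (w : List A) → All (x ∈_) (insertions x w)
  ∈-insertions-new x []       = here refl ∷ []
  ∈-insertions-new x (y ∷ ys) = here refl ∷ map⁺ (All.map there (∈-insertions-new x ys))

  ∈-insertions-old : {v : A} (x : A) {w : List A} → v ∈ w → All (v ∈_) (insertions x w)
  ∈-insertions-old x {y ∷ ys} (here v≡y)  = there (here v≡y) ∷ map⁺ (All.universal (λ _ → here v≡y) _)
  ∈-insertions-old x {y ∷ ys} (there v∈ys) = there (there v∈ys) ∷ map⁺ (All.map there (∈-insertions-old x v∈ys))

  ∈-perms : {v : A} {xs : List A} → v ∈ xs → All (v ∈_) (perms xs)
  ∈-perms {xs = x ∷ xs} (here refl) = concat⁺ (map⁺ (All.universal (∈-insertions-new x) (perms xs)))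
  ∈-perms {xs = x ∷ xs} (there v∈xs) = concat⁺ (map⁺ (All.map (∈-insertions-old x) (∈-perms v∈xs)))

tabulate-toℕ : ∀ k (g : ℕ → ℕ) → tabulate {n = k} (g ∘ toℕ) ≡ applyUpTo g k
tabulate-toℕ zero    g = refl
tabulate-toℕ (suc k) g = cong (g 0 ∷_) (tabulate-toℕ k (g ∘ suc))

map-toℕ-allFin : ∀ n → map toℕ (allFin n) ≡ upTo n
map-toℕ-allFin n = trans (map-tabulate id toℕ) (tabulate-toℕ n id)

-- The permanent as a number of admissible arrangements

W : ℕ → List ℤ
W m = -[1+ 1 ] ∷ -[1+ 0 ] ∷ ℤ.+ m ∷ []

-- π(i) - i ∈ {-2, -1, m} is written 2 + π(i) = i + c with c ∈ {0, 1, 2 + m}, avoiding ℤ.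
validStep : ℕ → ℕ → ℕ → Bool
validStep m p v = ⌊ 2 + v ≟ p + 0 ⌋ ∨ ⌊ 2 + v ≟ p + 1 ⌋ ∨ ⌊ 2 + v ≟ p + (2 + m) ⌋

admissibleFrom : ℕ → ℕ → List ℕ → Bool
admissibleFrom m p []       = true
admissibleFrom m p (v ∷ vs) = validStep m p v ∧ admissibleFrom m (suc p) vs

⊖≡-[1+]⇒ : ∀ a b k → a ⊖ b ≡ -[1+ k ] → suc k + a ≡ b
⊖≡-[1+]⇒ zero    zero    k ()
⊖≡-[1+]⇒ zero    (suc b) k refl = cong suc (+-identityʳ b)
⊖≡-[1+]⇒ (suc a) zero    k ()
⊖≡-[1+]⇒ (suc a) (suc b) k e =
  trans (+-suc (suc k) a) (cong suc (⊖≡-[1+]⇒ a b k (trans (sym ([1+m]⊖[1+n]≡m⊖n a b)) e)))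

⊖≡-[1+]⇐ : ∀ a k → a ⊖ (suc k + a) ≡ -[1+ k ]
⊖≡-[1+]⇐ zero    k = cong -[1+_] (+-identityʳ k)
⊖≡-[1+]⇐ (suc a) k = trans (cong (suc a ⊖_) (+-suc (suc k) a))
                           (trans ([1+m]⊖[1+n]≡m⊖n a (suc k + a)) (⊖≡-[1+]⇐ a k))

⊖≡+⇒ : ∀ a b k → a ⊖ b ≡ ℤ.+ k → a ≡ b + k
⊖≡+⇒ zero    zero    k refl = refl
⊖≡+⇒ zero    (suc b) k ()
⊖≡+⇒ (suc a) zero    k refl = refl
⊖≡+⇒ (suc a) (suc b) k e = cong suc (⊖≡+⇒ a b k (trans (sym ([1+m]⊖[1+n]≡m⊖n a b)) e))

⊖≡+⇐ : ∀ b k → (b + k) ⊖ b ≡ ℤ.+ k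
⊖≡+⇐ zero    k = refl
⊖≡+⇐ (suc b) k = trans ([1+m]⊖[1+n]≡m⊖n (b + k) b) (⊖≡+⇐ b k)

2+[p+m]≡p+[2+m] : ∀ p m → 2 + (p + m) ≡ p + (2 + m)
2+[p+m]≡p+[2+m] = solve-∀

any-W≡validStep : ∀ m p v → any (λ d → ⌊ ℤ.+ v ℤ.- ℤ.+ p ℤ.≟ d ⌋) (W m) ≡ validStep m p v
any-W≡validStep m p v rewrite [+m]-[+n]≡m⊖n v p =
  cong₂ _∨_ (⌊⌋-⇔ (λ e → trans (⊖≡-[1+]⇒ v p 1 e) (sym (+-identityʳ p)))
                  (λ e → subst (λ x → v ⊖ x ≡ -[1+ 1 ]) (trans e (+-identityʳ p)) (⊖≡-[1+]⇐ v 1))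
                  (v ⊖ p ℤ.≟ -[1+ 1 ]) (2 + v ≟ p + 0))
  (cong₂ _∨_ (⌊⌋-⇔ (λ e → trans (cong suc (⊖≡-[1+]⇒ v p 0 e)) (+-comm 1 p))
                   (λ e → subst (λ x → v ⊖ x ≡ -[1+ 0 ]) (suc-injective (trans e (+-comm p 1))) (⊖≡-[1+]⇐ v 0))
                   (v ⊖ p ℤ.≟ -[1+ 0 ]) (2 + v ≟ p + 1))
  (trans (∨-identityʳ _)
         (⌊⌋-⇔ (λ e → trans (cong (λ x → 2 + x) (⊖≡+⇒ v p m e)) (2+[p+m]≡p+[2+m] p m))
               (λ e → subst (λ x → x ⊖ p ≡ ℤ.+ m) (sym (+-cancelˡ-≡ 2 v (p + m) (trans e (sym (2+[p+m]≡p+[2+m] p m)))))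
                            (⊖≡+⇐ p m))
               (v ⊖ p ℤ.≟ ℤ.+ m) (2 + v ≟ p + (2 + m)))))

admissible≡admissibleFrom : ∀ m {N} k (f : ℕ → ℕ) p (w : List (Fin N)) → (∀ i → f i ≡ p + i) → length w ≡ k →
  all (λ { (i , v) → any (λ d → ⌊ ℤ.+ toℕ v ℤ.- ℤ.+ i ℤ.≟ d ⌋) (W m) }) (zip (applyUpTo f k) w)
    ≡ admissibleFrom m p (map toℕ w)
admissible≡admissibleFrom m zero    f p []      f≗p+ refl = refl
admissible≡admissibleFrom m (suc k) f p (v ∷ w) f≗p+ len  = cong₂ _∧_
  (trans (cong (λ i → any (λ d → ⌊ ℤ.+ toℕ v ℤ.- ℤ.+ i ℤ.≟ d ⌋) (W m)) (trans (f≗p+ 0) (+-identityʳ p)))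
         (any-W≡validStep m p (toℕ v)))
  (admissible≡admissibleFrom m k (f ∘ suc) (suc p) w (λ i → trans (f≗p+ (suc i)) (+-suc p i)) (suc-injective len))

P≡count : ∀ m n → P (W m) n ≡ sumBy (indicator (admissibleFrom m 0)) (perms (upTo n))
P≡count m n = begin
  P (W m) n
    ≡⟨ length-filterᵇ (admissible (W m) n) (perms (allFin n)) ⟩
  sumBy (indicator (admissible (W m) n)) (perms (allFin n))
    ≡⟨ sumBy-congᴬ (All.map (cong (λ b → if b then 1 else 0) ∘ admissible-toℕ) (length-perms (allFin n))) ⟩
  sumBy (indicator (admissibleFrom m 0) ∘ map toℕ) (perms (allFin n))
    ≡⟨ sym (sumBy-map (indicator (admissibleFrom m 0)) (map toℕ) (perms (allFin n))) ⟩
  sumBy (indicator (admissibleFrom m 0)) (map (map toℕ) (perms (allFin n)))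
    ≡⟨ cong (sumBy (indicator (admissibleFrom m 0))) (sym (perms-map toℕ (allFin n))) ⟩
  sumBy (indicator (admissibleFrom m 0)) (perms (map toℕ (allFin n)))
    ≡⟨ cong (sumBy (indicator (admissibleFrom m 0)) ∘ perms) (map-toℕ-allFin n) ⟩
  sumBy (indicator (admissibleFrom m 0)) (perms (upTo n)) ∎
  where
  admissible-toℕ : ∀ {w} → length w ≡ length (allFin n) → admissible (W m) n w ≡ admissibleFrom m 0 (map toℕ w)
  admissible-toℕ {w} len = admissible≡admissibleFrom m n id 0 w (λ _ → refl) (trans len (length-tabulate id))

offset-injective : ∀ {p a b y} → 2 + y ≡ p + a → 2 + y ≡ p + b → a ≡ b
offset-injective {p} e₁ e₂ = +-cancelˡ-≡ p _ _ (trans (sym e₁) e₂)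

validStep-split : ∀ m p y x → (if validStep m p y then x else 0) ≡
  (if ⌊ 2 + y ≟ p + 0 ⌋ then x else 0) + (if ⌊ 2 + y ≟ p + 1 ⌋ then x else 0) + (if ⌊ 2 + y ≟ p + (2 + m) ⌋ then x else 0)
validStep-split m p y x with 2 + y ≟ p + 0 | 2 + y ≟ p + 1 | 2 + y ≟ p + (2 + m)
... | yes e₀ | yes e₁ | _      with () ← offset-injective {p} e₀ e₁
... | yes e₀ | no _   | yes e₂ with () ← offset-injective {p} e₀ e₂
... | no _   | yes e₁ | yes e₂ with () ← offset-injective {p} e₁ e₂
... | yes _  | no _   | no _   = sym (trans (+-identityʳ (x + 0)) (+-identityʳ x))
... | no _   | yes _  | no _   = sym (+-identityʳ x)
... | no _   | no _   | yes _  = refl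
... | no _   | no _   | no _   = refl

validStep-stale : ∀ m {p v} → 2 + v < p → validStep m p v ≡ false
validStep-stale m {p} {v} 2+v<p = cong₂ _∨_ (missed 0) (cong₂ _∨_ (missed 1) (missed (2 + m)))
  where
  missed : ∀ c → ⌊ 2 + v ≟ p + c ⌋ ≡ false
  missed c = ⌊⌋-no (2 + v ≟ p + c) (λ e → <⇒≱ 2+v<p (subst (p ≤_) (sym e) (m≤m+n p c)))

admissibleFrom-stale : ∀ m {v} p w → v ∈ w → 2 + v < p → admissibleFrom m p w ≡ false
admissibleFrom-stale m p (v ∷ w) (here refl) 2+v<p = cong (_∧ admissibleFrom m (suc p) w) (validStep-stale m 2+v<p)
admissibleFrom-stale m p (u ∷ w) (there v∈w) 2+v<p =
  trans (cong (validStep m p u ∧_) (admissibleFrom-stale m (suc p) w v∈w (m<n⇒m<1+n 2+v<p))) (∧-zeroʳ _)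

-- A transfer recursion for the permanent

data Offset (q w : ℕ) : Set where
  below : w < q → Offset q w
  at    : ∀ t → w ≡ q + t → Offset q w

offset : ∀ q w → Offset q w
offset q w with q ≤? w
... | yes q≤w = at (w ∸ q) (sym (m+[n∸m]≡n q≤w))
... | no  q≰w = below (≰⇒> q≰w)

-- The values still unused before position q: all v with q ≤ v + 2 whose offset v + 2 - q satisfies F.
state : ℕ → (ℕ → Bool) → ℕ → Bool
state q F v = ⌊ q ≤? 2 + v ⌋ ∧ F (2 + v ∸ q)

state-at : ∀ q F {v t} → 2 + v ≡ q + t → state q F v ≡ F t
state-at q F {v} {t} e = cong₂ _∧_ (⌊⌋-yes (q ≤? 2 + v) (subst (q ≤_) (sym e) (m≤m+n q t)))
                                   (cong F (trans (cong (_∸ q) e) (m+n∸m≡n q t)))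

state-below : ∀ q F {v} → 2 + v < q → state q F v ≡ false
state-below q F {v} 2+v<q = cong (_∧ F (2 + v ∸ q)) (⌊⌋-no (q ≤? 2 + v) (<⇒≱ 2+v<q))

_∖_ : (ℕ → Bool) → ℕ → ℕ → Bool
(S ∖ y) v = S v ∧ not ⌊ v ≟ y ⌋

state-∖ : ∀ q F G {y c} → 2 + y ≡ q + c → F 0 ∧ not ⌊ 0 ≟ c ⌋ ≡ false →
          (∀ t → F (suc t) ∧ not ⌊ suc t ≟ c ⌋ ≡ G t) → ∀ v → (state q F ∖ y) v ≡ state (suc q) G v
state-∖ q F G {y} {c} ey h₀ hₛ v with offset q (2 + v)
... | below 2+v<q = trans (cong (_∧ _) (state-below q F 2+v<q))
                         (sym (state-below (suc q) G (m<n⇒m<1+n 2+v<q)))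
... | at t e = begin
  state q F v ∧ not ⌊ v ≟ y ⌋  ≡⟨ cong₂ (λ x b → x ∧ not b) (state-at q F e) (⌊⌋-⇔ v≡y⇒t≡c t≡c⇒v≡y (v ≟ y) (t ≟ c)) ⟩
  F t ∧ not ⌊ t ≟ c ⌋          ≡⟨ shifted t e ⟩
  state (suc q) G v            ∎
  where
  v≡y⇒t≡c : v ≡ y → t ≡ c
  v≡y⇒t≡c refl = offset-injective {q} e ey
  t≡c⇒v≡y : t ≡ c → v ≡ y
  t≡c⇒v≡y refl = suc-injective (suc-injective (trans e (sym ey)))
  shifted : ∀ t → 2 + v ≡ q + t → F t ∧ not ⌊ t ≟ c ⌋ ≡ state (suc q) G v
  shifted zero    e = trans h₀ (sym (state-below (suc q) G (s≤s (≤-reflexive (trans e (+-identityʳ q))))))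
  shifted (suc t) e = trans (hₛ t) (sym (state-at (suc q) G (trans e (+-suc q t))))

gap : ℕ → ℕ → ℕ → Bool
gap α β t = not ⌊ t ≟ α ⌋ ∧ not ⌊ t ≟ β ⌋

gap-forced : ∀ a b t → gap (suc a) (suc b) (suc t) ∧ not ⌊ suc t ≟ 0 ⌋ ≡ gap a b t
gap-forced a b t = trans (∧-identityʳ _) (cong₂ (λ x y → not x ∧ not y) (suc-≟ t a) (suc-≟ t b))

gap-adjacent : ∀ b t → gap 0 (2 + b) (suc t) ∧ not ⌊ suc t ≟ 1 ⌋ ≡ gap 0 (suc b) t
gap-adjacent b zero    = ∧-zeroʳ (gap 0 (2 + b) 1)
gap-adjacent b (suc t) = trans (∧-identityʳ _) (cong not (suc-≟ (suc t) (suc b)))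

gap-jump : ∀ m b t → gap 0 (suc b) (suc t) ∧ not ⌊ suc t ≟ 2 + m ⌋ ≡ gap b (suc m) t
gap-jump m b t = cong₂ (λ x y → not x ∧ not y) (suc-≟ t b) (suc-≟ t (suc m))

-- Completions of the last k positions from state q (gap α β), in which the values q - 2 + α and
-- q - 2 + β are used: if q - 2 is unused (α > 0) it must go to position q; otherwise q takes q - 1
-- (unless β = 1) or q + m (if that value exists).
completions : ℕ → ℕ → ℕ → ℕ → ℕ
completions m zero    α       β = 1
completions m (suc k) (suc α) β = completions m k α (β ∸ 1)
completions m (suc k) zero    β = (if ⌊ β ≟ 1 ⌋ then 0 else completions m k 0 (β ∸ 1))
                                + (if ⌊ m <? suc k ⌋ then completions m k (β ∸ 1) (suc m) else 0)

module Arrangements (m n : ℕ) where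

  values : (ℕ → Bool) → List ℕ
  values S = filterᵇ S (upTo n)

  arrangements : ℕ → (ℕ → Bool) → ℕ
  arrangements p S = sumBy (indicator (admissibleFrom m p)) (perms (values S))

  withHead : ℕ → (ℕ → Bool) → ℕ → ℕ
  withHead p S y = if S y then arrangements (suc p) (S ∖ y) else 0

  withHeadAt : ℕ → (ℕ → Bool) → ℕ → ℕ
  withHeadAt p S c = sumBy (λ y → if ⌊ 2 + y ≟ p + c ⌋ then withHead p S y else 0) (upTo n)

  arrangements-cong : ∀ p {S S′} → (∀ v → S v ≡ S′ v) → arrangements p S ≡ arrangements p S′
  arrangements-cong p S≗S′ = cong (sumBy (indicator (admissibleFrom m p)) ∘ perms) (filterᵇ-cong S≗S′ (upTo n))

  ∈-values : ∀ {S v} → S v ≡ true → v < n → v ∈ values S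
  ∈-values {S} Sv v<n = ∈-filter⁺ (T? ∘ S) (∈-upTo⁺ v<n) (subst T (sym Sv) tt)

  arrangements-expand : ∀ p S {v} → S v ≡ true → v < n →
    arrangements p S ≡ sumBy (λ y → if validStep m p y then withHead p S y else 0) (upTo n)
  arrangements-expand p S Sv v<n = begin
    sumBy h (perms (values S))
      ≡⟨ sumBy-perms-unique h (values S) (filter⁺ (T? ∘ S) (upTo⁺ n)) values≢[] ⟩
    sumBy (λ y → sumBy (h ∘ (y ∷_)) (perms (remove y (values S)))) (values S)
      ≡⟨ sumBy-cong (λ y → cong (sumBy (h ∘ (y ∷_)) ∘ perms) (filterᵇ-filterᵇ _ S (upTo n))) (values S) ⟩
    sumBy (λ y → sumBy (h ∘ (y ∷_)) (perms (values (S ∖ y)))) (values S)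
      ≡⟨ sumBy-cong (λ y → first-step y (perms (values (S ∖ y)))) (values S) ⟩
    sumBy (λ y → if validStep m p y then arrangements (suc p) (S ∖ y) else 0) (values S)
      ≡⟨ sumBy-filterᵇ _ S (upTo n) ⟩
    sumBy (λ y → if S y then (if validStep m p y then arrangements (suc p) (S ∖ y) else 0) else 0) (upTo n)
      ≡⟨ sumBy-cong swap (upTo n) ⟩
    sumBy (λ y → if validStep m p y then withHead p S y else 0) (upTo n) ∎
    where
    h : List ℕ → ℕ
    h = indicator (admissibleFrom m p)
    values≢[] : ¬ values S ≡ []
    values≢[] e with () ← subst (_ ∈_) e (∈-values Sv v<n)
    first-step : ∀ y ws → sumBy (h ∘ (y ∷_)) ws ≡ (if validStep m p y then sumBy (indicator (admissibleFrom m (suc p))) ws else 0)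
    first-step y ws with validStep m p y
    ... | true  = refl
    ... | false = sumBy-zero ws
    swap : ∀ y → (if S y then (if validStep m p y then arrangements (suc p) (S ∖ y) else 0) else 0)
                 ≡ (if validStep m p y then withHead p S y else 0)
    swap y with S y
    ... | true  = refl
    ... | false = sym (if-same (validStep m p y) 0)

  arrangements-split : ∀ p S {v} → S v ≡ true → v < n →
    arrangements p S ≡ withHeadAt p S 0 + withHeadAt p S 1 + withHeadAt p S (2 + m)
  arrangements-split p S Sv v<n = begin
    arrangements p S
      ≡⟨ arrangements-expand p S Sv v<n ⟩
    sumBy (λ y → if validStep m p y then withHead p S y else 0) (upTo n)
      ≡⟨ sumBy-cong (λ y → validStep-split m p y (withHead p S y)) (upTo n) ⟩
    sumBy (λ y → term 0 y + term 1 y + term (2 + m) y) (upTo n)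
      ≡⟨ sumBy-+ (λ y → term 0 y + term 1 y) (term (2 + m)) (upTo n) ⟩
    sumBy (λ y → term 0 y + term 1 y) (upTo n) + withHeadAt p S (2 + m)
      ≡⟨ cong (_+ withHeadAt p S (2 + m)) (sumBy-+ (term 0) (term 1) (upTo n)) ⟩
    withHeadAt p S 0 + withHeadAt p S 1 + withHeadAt p S (2 + m) ∎
    where
    term : ℕ → ℕ → ℕ
    term c y = if ⌊ 2 + y ≟ p + c ⌋ then withHead p S y else 0

  withHeadAt-≡ : ∀ p S c {y} → y < n → 2 + y ≡ p + c → withHeadAt p S c ≡ withHead p S y
  withHeadAt-≡ p S c {y} y<n e = begin
    withHeadAt p S c
      ≡⟨ sumBy-cong (λ y′ → cong (if_then withHead p S y′ else 0)
                               (⌊⌋-⇔ (λ e′ → suc-injective (suc-injective (trans e′ (sym e)))) (λ { refl → e })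
                                     (2 + y′ ≟ p + c) (y′ ≟ y))) (upTo n) ⟩
    sumBy (λ y′ → if ⌊ y′ ≟ y ⌋ then withHead p S y′ else 0) (upTo n)
      ≡⟨ sumBy-upTo-≟ n y (withHead p S) ⟩
    (if ⌊ y <? n ⌋ then withHead p S y else 0)
      ≡⟨ if-⌊yes⌋ (y <? n) y<n _ 0 ⟩
    withHead p S y ∎

  withHeadAt-≡0 : ∀ p S c → (∀ y → y < n → 2 + y ≡ p + c → withHead p S y ≡ 0) → withHeadAt p S c ≡ 0
  withHeadAt-≡0 p S c none = trans (sumBy-congᴬ (applyUpTo⁺₁ id n (λ {y} → term y))) (sumBy-zero (upTo n))
    where
    term : ∀ y → y < n → (if ⌊ 2 + y ≟ p + c ⌋ then withHead p S y else 0) ≡ 0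
    term y y<n with 2 + y ≟ p + c
    ... | yes e = none y y<n e
    ... | no  _ = refl

  arrangements-stale : ∀ p S {v} → S v ≡ true → v < n → 2 + v < p → arrangements p S ≡ 0
  arrangements-stale p S Sv v<n 2+v<p =
    trans (sumBy-congᴬ (All.map (λ v∈w → cong (if_then 1 else 0) (admissibleFrom-stale m p _ v∈w 2+v<p))
                                (∈-perms (∈-values Sv v<n))))
          (sumBy-zero (perms (values S)))

  withHead-stale : ∀ p S {v y} → S v ≡ true → v < n → 2 + v ≤ p → ¬ v ≡ y → withHead p S y ≡ 0
  withHead-stale p S {v} {y} Sv v<n 2+v≤p v≢y with S y
  ... | false = refl
  ... | true  = arrangements-stale (suc p) (S ∖ y) Sv∖y v<n (s≤s 2+v≤p)
    where
    Sv∖y : (S ∖ y) v ≡ true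
    Sv∖y = cong₂ (λ a b → a ∧ not b) Sv (⌊⌋-no (v ≟ y) v≢y)

  -- Invariants of the states reached from q = 0, gap 0 1, where the nonexistent values -2 and -1
  -- count as used.
  record Reachable (k q α β : ℕ) : Set where
    field
      remaining   : q + k ≡ n
      α<β         : α < β
      β≤1+m       : β ≤ suc m
      q+β≤1+n     : q + β ≤ suc n
      0<α⇒2≤q     : 0 < α → 2 ≤ q
      q≡0⇒β≡1     : q ≡ 0 → β ≡ 1
  open Reachable

  Completes : ℕ → ℕ → Set
  Completes k q = ∀ α β → Reachable k q α β → arrangements q (state q (gap α β)) ≡ completions m k α β

  q<n : ∀ {k q α β} → Reachable (suc k) q α β → q < n
  q<n {k} {q} r = subst (q <_) (remaining r) (subst (_≤ q + suc k) (+-comm q 1) (+-monoʳ-≤ q (s≤s z≤n)))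

  remaining-suc : ∀ {k q α β} → Reachable (suc k) q α β → suc q + k ≡ n
  remaining-suc {k} {q} r = trans (sym (+-suc q k)) (remaining r)

  Reachable-zero : ∀ {q α β} → Reachable 0 q α β → q ≡ n × α ≡ 0 × β ≡ 1
  Reachable-zero {q} {zero} {suc zero} r = trans (sym (+-identityʳ q)) (remaining r) , refl , refl
  Reachable-zero {q} {α} {zero} r with () ← α<β r
  Reachable-zero {q} {suc α} {suc zero} r with s≤s () ← α<β r
  Reachable-zero {q} {α} {suc (suc β)} r = ⊥-elim (m+1+n≰m n (≤-pred (subst (_≤ suc n) (+-suc n (suc β)) n+β≤1+n)))
    where
    n+β≤1+n : n + suc (suc β) ≤ suc n
    n+β≤1+n = subst (λ x → x + suc (suc β) ≤ suc n) (trans (sym (+-identityʳ q)) (remaining r)) (q+β≤1+n r)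

  reachable-forced : ∀ {k q′ a b} → Reachable (suc k) (2 + q′) (suc a) (suc b) → Reachable k (3 + q′) a b
  reachable-forced {q′ = q′} {b = b} r = record
    { remaining = remaining-suc r
    ; α<β       = ≤-pred (α<β r)
    ; β≤1+m     = m≤n⇒m≤1+n (≤-pred (β≤1+m r))
    ; q+β≤1+n   = subst (_≤ suc n) (+-suc (2 + q′) b) (q+β≤1+n r)
    ; 0<α⇒2≤q   = λ _ → s≤s (s≤s z≤n)
    ; q≡0⇒β≡1   = λ ()
    }

  reachable-adjacent : ∀ {k q″ b} → Reachable (suc k) (suc q″) 0 (2 + b) → Reachable k (2 + q″) 0 (suc b)
  reachable-adjacent {q″ = q″} {b = b} r = record
    { remaining = remaining-suc r
    ; α<β       = s≤s z≤n
    ; β≤1+m     = ≤-trans (n≤1+n _) (β≤1+m r)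
    ; q+β≤1+n   = subst (_≤ suc n) (+-suc (suc q″) (suc b)) (q+β≤1+n r)
    ; 0<α⇒2≤q   = λ ()
    ; q≡0⇒β≡1   = λ ()
    }

  reachable-jump : ∀ {k q b} → Reachable (suc k) q 0 (suc b) → q + m < n → Reachable k (suc q) b (suc m)
  reachable-jump {k} {q} {b} r q+m<n = record
    { remaining = remaining-suc r
    ; α<β       = β≤1+m r
    ; β≤1+m     = ≤-refl
    ; q+β≤1+n   = subst (λ x → suc x ≤ suc n) (sym (+-suc q m)) (s≤s q+m<n)
    ; 0<α⇒2≤q   = s≤s ∘ 0<b⇒1≤q (q≡0⇒β≡1 r)
    ; q≡0⇒β≡1   = λ ()
    }
    where
    0<b⇒1≤q : ∀ {q} → (q ≡ 0 → suc b ≡ 1) → 0 < b → 1 ≤ q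
    0<b⇒1≤q {suc _} _   _   = s≤s z≤n
    0<b⇒1≤q {zero}  b≡0 0<b = ⊥-elim (<-irrefl (sym (suc-injective (b≡0 refl))) 0<b)

  withHeadAt-transition : ∀ {k q} F {y c α′ β′} → y < n → 2 + y ≡ q + c → F c ≡ true →
    F 0 ∧ not ⌊ 0 ≟ c ⌋ ≡ false → (∀ t → F (suc t) ∧ not ⌊ suc t ≟ c ⌋ ≡ gap α′ β′ t) →
    Completes k (suc q) → Reachable k (suc q) α′ β′ → withHeadAt q (state q F) c ≡ completions m k α′ β′
  withHeadAt-transition {k} {q} F {y} {c} {α′} {β′} y<n e Fc h₀ hₛ complete r = begin
    withHeadAt q (state q F) c                        ≡⟨ withHeadAt-≡ q (state q F) c y<n e ⟩
    withHead q (state q F) y                          ≡⟨ cong (if_then arrangements (suc q) (state q F ∖ y) else 0) (trans (state-at q F e) Fc) ⟩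
    arrangements (suc q) (state q F ∖ y)              ≡⟨ arrangements-cong (suc q) (state-∖ q F (gap α′ β′) e h₀ hₛ) ⟩
    arrangements (suc q) (state (suc q) (gap α′ β′)) ≡⟨ complete α′ β′ r ⟩
    completions m k α′ β′                             ∎

  withHead-used : ∀ q F {y c} → F c ≡ false → 2 + y ≡ q + c → withHead q (state q F) y ≡ 0
  withHead-used q F {y} Fc e = cong (if_then arrangements (suc q) (state q F ∖ y) else 0) (trans (state-at q F e) Fc)

  arrangements-forced : ∀ {k q′ a b} → Reachable (suc k) (2 + q′) (suc a) (suc b) → Completes k (3 + q′) →
    arrangements (2 + q′) (state (2 + q′) (gap (suc a) (suc b))) ≡ completions m k a b
  arrangements-forced {k} {q′} {a} {b} r complete = begin
    arrangements q S
      ≡⟨ arrangements-split q S (state-at q (gap (suc a) (suc b)) e) q′<n ⟩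
    withHeadAt q S 0 + withHeadAt q S 1 + withHeadAt q S (2 + m)
      ≡⟨ cong₂ _+_ (cong₂ _+_ (withHeadAt-transition (gap (suc a) (suc b)) q′<n e refl (∧-zeroʳ (gap (suc a) (suc b) 0)) (gap-forced a b)
                                                    complete (reachable-forced r))
                              (blocked 1 λ ()))
                   (blocked (2 + m) λ ()) ⟩
    completions m k a b + 0 + 0
      ≡⟨ trans (+-identityʳ _) (+-identityʳ _) ⟩
    completions m k a b ∎
    where
    q = 2 + q′
    S = state q (gap (suc a) (suc b))
    e : 2 + q′ ≡ q + 0
    e = sym (+-identityʳ q)
    q′<n : q′ < n
    q′<n = m+n≤o⇒n≤o 2 (q<n r)
    blocked : ∀ c → ¬ 0 ≡ c → withHeadAt q S c ≡ 0
    blocked c 0≢c = withHeadAt-≡0 q S c (λ y _ e′ →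
      withHead-stale q S (state-at q (gap (suc a) (suc b)) e) q′<n ≤-refl (λ { refl → 0≢c (offset-injective {q} e e′) }))

  choice-witness : ∀ {k q b} → Reachable (suc k) q 0 (suc b) → Σ ℕ λ v → state q (gap 0 (suc b)) v ≡ true × v < n
  choice-witness {k} {q}      {zero}  r = q , state-at q (gap 0 1) (+-comm 2 q) , q<n r
  choice-witness {k} {zero}   {suc b} r with () ← q≡0⇒β≡1 r refl
  choice-witness {k} {suc q″} {suc b} r =
    q″ , state-at (suc q″) (gap 0 (2 + b)) (cong suc (+-comm 1 q″)) , <-trans (n<1+n q″) (q<n r)

  choice-adjacent : ∀ {k q b} → Reachable (suc k) q 0 (suc b) → Completes k (suc q) →
    withHeadAt q (state q (gap 0 (suc b))) 1 ≡ (if ⌊ suc b ≟ 1 ⌋ then 0 else completions m k 0 b)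
  choice-adjacent {k} {q}      {zero}  r complete =
    withHeadAt-≡0 q (state q (gap 0 1)) 1 (λ y _ e → withHead-used q (gap 0 1) refl e)
  choice-adjacent {k} {zero}   {suc b} r complete with () ← q≡0⇒β≡1 r refl
  choice-adjacent {k} {suc q″} {suc b} r complete =
    withHeadAt-transition (gap 0 (2 + b)) (<-trans (n<1+n q″) (q<n r)) (cong suc (+-comm 1 q″)) refl refl (gap-adjacent b)
                          complete (reachable-adjacent r)

  choice-jump : ∀ {k q b} → Reachable (suc k) q 0 (suc b) → Completes k (suc q) →
    withHeadAt q (state q (gap 0 (suc b))) (2 + m) ≡ (if ⌊ m <? suc k ⌋ then completions m k b (suc m) else 0)
  choice-jump {k} {q} {b} r complete with m <? suc k
  ... | yes m<1+k = withHeadAt-transition (gap 0 (suc b)) q+m<n (2+[p+m]≡p+[2+m] q m) free refl (gap-jump m b) complete (reachable-jump r q+m<n)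
    where
    q+m<n : q + m < n
    q+m<n = subst (q + m <_) (remaining r) (+-monoʳ-< q m<1+k)
    free : gap 0 (suc b) (2 + m) ≡ true
    free = cong not (⌊⌋-no (2 + m ≟ suc b) (λ 2+m≡1+b → 1+n≰n (subst (_≤ suc m) (sym 2+m≡1+b) (β≤1+m r))))
  ... | no m≮1+k = withHeadAt-≡0 q (state q (gap 0 (suc b))) (2 + m) (λ y y<n e′ → ⊥-elim (m≮1+k
      (+-cancelˡ-< q m (suc k) (subst (_< q + suc k) (+-cancelˡ-≡ 2 y (q + m) (trans e′ (sym (2+[p+m]≡p+[2+m] q m))))
                                      (subst (y <_) (sym (remaining r)) y<n)))))

  arrangements-choice : ∀ {k q b} → Reachable (suc k) q 0 (suc b) → Completes k (suc q) →
    arrangements q (state q (gap 0 (suc b))) ≡ completions m (suc k) 0 (suc b)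
  arrangements-choice {k} {q} {b} r complete with choice-witness r
  ... | v , Sv , v<n = begin
    arrangements q S
      ≡⟨ arrangements-split q S Sv v<n ⟩
    withHeadAt q S 0 + withHeadAt q S 1 + withHeadAt q S (2 + m)
      ≡⟨ cong₂ _+_ (cong₂ _+_ (withHeadAt-≡0 q S 0 (λ y _ → withHead-used q (gap 0 (suc b)) refl))
                              (choice-adjacent r complete))
                   (choice-jump r complete) ⟩
    completions m (suc k) 0 (suc b) ∎
    where
    S = state q (gap 0 (suc b))

  arrangements-final : arrangements n (state n (gap 0 1)) ≡ 1
  arrangements-final = cong (sumBy (indicator (admissibleFrom m n)) ∘ perms)
                            (filterᵇ-none (applyUpTo⁺₁ id n (λ {v} → unused v)))
    where
    unused : ∀ v → v < n → state n (gap 0 1) v ≡ false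
    unused v v<n with offset n (2 + v)
    ... | below 2+v<n            = state-below n (gap 0 1) 2+v<n
    ... | at zero e              = state-at n (gap 0 1) e
    ... | at (suc zero) e        = state-at n (gap 0 1) e
    ... | at (suc (suc t)) e     = ⊥-elim (<⇒≱ (s≤s (s≤s v<n))
      (subst (2 + n ≤_) (sym e) (subst (_≤ n + suc (suc t)) (+-comm n 2) (+-monoʳ-≤ n (s≤s (s≤s z≤n))))))

  arrangements-state : ∀ k q α β → Reachable k q α β → arrangements q (state q (gap α β)) ≡ completions m k α β
  arrangements-state zero q α β r with Reachable-zero r
  ... | refl , refl , refl = arrangements-final
  arrangements-state (suc k) q       zero    zero    r with () ← α<β r
  arrangements-state (suc k) q       (suc a) zero    r with () ← α<β r
  arrangements-state (suc k) q       zero    (suc b) r = arrangements-choice r (arrangements-state k (suc q))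
  arrangements-state (suc k) zero    (suc a) (suc b) r with () ← 0<α⇒2≤q r (s≤s z≤n)
  arrangements-state (suc k) (suc zero) (suc a) (suc b) r with s≤s () ← 0<α⇒2≤q r (s≤s z≤n)
  arrangements-state (suc k) (suc (suc q′)) (suc a) (suc b) r = arrangements-forced r (arrangements-state k (3 + q′))

P≡completions : ∀ m n → P (W m) n ≡ completions m n 0 1
P≡completions m n = begin
  P (W m) n
    ≡⟨ P≡count m n ⟩
  sumBy (indicator (admissibleFrom m 0)) (perms (upTo n))
    ≡⟨ cong (sumBy (indicator (admissibleFrom m 0)) ∘ perms) (sym (filterᵇ-all (λ _ → refl) (upTo n))) ⟩
  arrangements 0 (state 0 (gap 0 1))
    ≡⟨ arrangements-state n 0 0 1 start ⟩
  completions m n 0 1 ∎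
  where
  open Arrangements m n
  start : Reachable n 0 0 1
  start = record
    { remaining = refl
    ; α<β       = s≤s z≤n
    ; β≤1+m     = s≤s z≤n
    ; q+β≤1+n   = s≤s z≤n
    ; 0<α⇒2≤q   = λ ()
    ; q≡0⇒β≡1   = λ _ → refl
    }

-- The coefficients b_e

completions-forced : ∀ m j a β → completions m (j + a) a β ≡ completions m j 0 (β ∸ a)
completions-forced m j zero    β = cong (λ k → completions m k 0 β) (+-identityʳ j)
completions-forced m j (suc a) β = begin
  completions m (j + suc a) (suc a) β ≡⟨ cong (λ k → completions m k (suc a) β) (+-suc j a) ⟩
  completions m (j + a) a (β ∸ 1)     ≡⟨ completions-forced m j a (β ∸ 1) ⟩
  completions m j 0 (β ∸ 1 ∸ a)       ≡⟨ cong (completions m j 0) (∸-+-assoc β 1 a) ⟩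
  completions m j 0 (β ∸ suc a)       ∎

-- coeff m e r is b_e(r); coeffPred m e is b_{e-1}, with b_{-1} = δ_0.
coeff : ℕ → ℕ → ℕ → ℕ
coeff m e r = completions m (r + e) 0 (suc e)

coeffPred : ℕ → ℕ → ℕ → ℕ
coeffPred m zero    r = if ⌊ r ≟ 0 ⌋ then 1 else 0
coeffPred m (suc e) r = coeff m e r

coeffMirror : ℕ → ℕ → ℕ → ℕ
coeffMirror m e r = if ⌊ suc (m ∸ e) ≤? r ⌋ then coeff m (m ∸ e) (r ∸ suc (m ∸ e)) else 0

coeff-rec : ∀ m e r → e ≤ m → coeff m e r ≡ coeffPred m e r + coeffMirror m e r
coeff-rec m zero    zero    _   = refl
coeff-rec m (suc e) zero    e<m = cong (coeff m e 0 +_) (if-⌊no⌋ (m <? suc e) (<⇒≱ e<m ∘ ≤-pred) _ 0)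
coeff-rec m e       (suc r) e≤m = cong₂ _+_ (pred-part e) mirror-part
  where
  pred-part : ∀ e → (if ⌊ suc e ≟ 1 ⌋ then 0 else completions m (r + e) 0 e) ≡ coeffPred m e (suc r)
  pred-part zero     = refl
  pred-part (suc e′) = cong (λ k → completions m k 0 (suc e′)) (+-suc r e′)
  mirror-part : (if ⌊ m <? suc (r + e) ⌋ then completions m (r + e) e (suc m) else 0) ≡ coeffMirror m e (suc r)
  mirror-part = if-⌊⌋-cong (m <? suc (r + e)) (suc (m ∸ e) ≤? suc r)
    (λ m<1+r+e → s≤s (m≤n+o⇒m∸n≤o m e (subst (m ≤_) (+-comm r e) (≤-pred m<1+r+e))))
    (λ 1+m∸e≤1+r → s≤s (subst (_≤ r + e) (m∸n+n≡m e≤m) (+-monoˡ-≤ e (≤-pred 1+m∸e≤1+r))))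
    (λ m<1+r+e → begin
      completions m (r + e) e (suc m)                  ≡⟨ completions-forced m r e (suc m) ⟩
      completions m r 0 (suc m ∸ e)                    ≡⟨ cong (completions m r 0) (+-∸-assoc 1 e≤m) ⟩
      completions m r 0 (suc (m ∸ e))                  ≡⟨ cong (λ k → completions m k 0 (suc (m ∸ e)))
                                                              (sym (m∸n+n≡m (m≤n+o⇒m∸n≤o m e (subst (m ≤_) (+-comm r e) (≤-pred m<1+r+e))))) ⟩
      coeff m (m ∸ e) (r ∸ (m ∸ e))                    ∎)

P≡coeff : ∀ m k i → i ≤ k → P (W m) (k + m + 1 ∸ i) ≡ coeff m m (k ∸ i)
P≡coeff m k i i≤k = begin
  P (W m) (k + m + 1 ∸ i)
    ≡⟨ P≡completions m (k + m + 1 ∸ i) ⟩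
  completions m (k + m + 1 ∸ i) 0 1
    ≡⟨ cong (λ x → completions m x 0 1) (trans (+-∸-comm 1 (≤-trans i≤k (m≤m+n k m))) (+-comm _ 1)) ⟩
  completions m (suc (k + m ∸ i)) 0 1
    ≡⟨ if-⌊yes⌋ (m <? suc (k + m ∸ i)) (s≤s (≤-trans (m≤n+m m (k ∸ i)) (≤-reflexive (sym (+-∸-comm m i≤k))))) _ 0 ⟩
  completions m (k + m ∸ i) 0 (suc m)
    ≡⟨ cong (λ x → completions m x 0 (suc m)) (+-∸-comm m i≤k) ⟩
  coeff m m (k ∸ i) ∎

-- Products of terms of s

sAux-fuel : ∀ m f g k → k ≤ f → k ≤ g → sAux m f k ≡ sAux m g k
sAux-fuel m f       g       zero    _         _         = refl
sAux-fuel m (suc f) (suc g) (suc k) (s≤s k≤f) (s≤s k≤g) = cong₂ _+_ (sAux-fuel m f g k k≤f k≤g)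
  (cong (if ⌊ suc m ≤? k ⌋ then_else 0)
        (sAux-fuel m f g (k ∸ suc m) (≤-trans (m∸n≤m k (suc m)) k≤f) (≤-trans (m∸n≤m k (suc m)) k≤g)))

s-suc : ∀ m k → s m (suc k) ≡ s m k + (if ⌊ suc m ≤? k ⌋ then s m (k ∸ suc m) else 0)
s-suc m k = cong (λ x → s m k + (if ⌊ suc m ≤? k ⌋ then x else 0))
                 (sAux-fuel m k (k ∸ suc m) (k ∸ suc m) (m∸n≤m k (suc m)) ≤-refl)

s-initial : ∀ m k → k ≤ suc m → s m k ≡ 1
s-initial m zero    _         = refl
s-initial m (suc k) (s≤s k≤m) = begin
  s m (suc k)
    ≡⟨ s-suc m k ⟩
  s m k + (if ⌊ suc m ≤? k ⌋ then s m (k ∸ suc m) else 0)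
    ≡⟨ cong₂ _+_ (s-initial m k (m≤n⇒m≤1+n k≤m)) (if-⌊no⌋ (suc m ≤? k) (<⇒≱ (s≤s k≤m)) _ 0) ⟩
  1 ∎

sq : ℕ → ℕ
sq x = x ℕ.* x

sumTo-coeffMirror : ∀ m e c′ (g : ℕ → ℕ) → let D = suc (m ∸ e) in
  sumTo (c′ + D) (λ j → coeffMirror m e (c′ + D ∸ j) ℕ.* g j) ≡ sumTo c′ (λ j → coeff m (m ∸ e) (c′ ∸ j) ℕ.* g j)
sumTo-coeffMirror m e c′ g = trans (sumTo-extend c′ D _ beyond) (sumTo-cong c′ within)
  where
  D = suc (m ∸ e)
  beyond : ∀ j → c′ < j → j ≤ c′ + D → coeffMirror m e (c′ + D ∸ j) ℕ.* g j ≡ 0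
  beyond j c′<j _ = cong (ℕ._* g j) (if-⌊no⌋ (D ≤? c′ + D ∸ j) (<⇒≱ short) _ 0)
    where
    short : c′ + D ∸ j < D
    short = s≤s (≤-trans (∸-monoʳ-≤ (c′ + D) c′<j)
                         (≤-reflexive (trans (cong (_∸ suc c′) (+-suc c′ (m ∸ e))) (m+n∸m≡n c′ (m ∸ e)))))
  within : ∀ j → j ≤ c′ → coeffMirror m e (c′ + D ∸ j) ℕ.* g j ≡ coeff m (m ∸ e) (c′ ∸ j) ℕ.* g j
  within j j≤c′ rewrite +-∸-comm D j≤c′ = cong (ℕ._* g j) (trans (if-⌊yes⌋ (D ≤? c′ ∸ j + D) (m≤n+m D (c′ ∸ j)) _ 0)
                                                              (cong (coeff m (m ∸ e)) (m+n∸n≡m (c′ ∸ j) D)))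

ProductFormula : ℕ → ℕ → Set
ProductFormula m c = ∀ e → e ≤ m → s m c ℕ.* s m (c + suc e) ≡ sumTo c (λ j → coeff m e (c ∸ j) ℕ.* sq (s m j))

-- The contribution of the term s_{c+e-m-1} of s_{c+e+1} = s_{c+e} + s_{c+e-m-1}.
MirrorTerm : ℕ → ℕ → ℕ → Set
MirrorTerm m e c = s m c ℕ.* (if ⌊ suc m ≤? c + e ⌋ then s m (c + e ∸ suc m) else 0)
                 ≡ sumTo c (λ j → coeffMirror m e (c ∸ j) ℕ.* sq (s m j))

mirror-term : ∀ m e c → e ≤ m → (∀ {c′} → c′ < c → ProductFormula m c′) → MirrorTerm m e c
mirror-term m e c e≤m ih = by-cases (suc (m ∸ e) ≤? c)
  where
  D = suc (m ∸ e)
  aligned : ∀ c′ → ProductFormula m c′ → MirrorTerm m e (c′ + D)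
  aligned c′ pf = begin
    s m (c′ + D) ℕ.* (if ⌊ suc m ≤? c′ + D + e ⌋ then s m (c′ + D + e ∸ suc m) else 0)
      ≡⟨ cong (s m (c′ + D) ℕ.*_) (trans (if-⌊yes⌋ (suc m ≤? c′ + D + e) (subst (suc m ≤_) (sym wrap) (m≤n+m (suc m) c′)) _ 0)
                                       (cong (s m) (trans (cong (_∸ suc m) wrap) (m+n∸n≡m c′ (suc m))))) ⟩
    s m (c′ + D) ℕ.* s m c′
      ≡⟨ *-comm (s m (c′ + D)) (s m c′) ⟩
    s m c′ ℕ.* s m (c′ + D)
      ≡⟨ pf (m ∸ e) (m∸n≤m m e) ⟩
    sumTo c′ (λ j → coeff m (m ∸ e) (c′ ∸ j) ℕ.* sq (s m j))
      ≡⟨ sym (sumTo-coeffMirror m e c′ (sq ∘ s m)) ⟩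
    sumTo (c′ + D) (λ j → coeffMirror m e (c′ + D ∸ j) ℕ.* sq (s m j)) ∎
    where
    wrap : c′ + D + e ≡ c′ + suc m
    wrap = trans (+-assoc c′ D e) (cong (λ x → c′ + suc x) (m∸n+n≡m e≤m))
  D≤c : suc m ≤ c + e → D ≤ c
  D≤c 1+m≤c+e = subst (_≤ c) (+-∸-assoc 1 e≤m) (m≤n+o⇒m∸n≤o (suc m) e (subst (suc m ≤_) (+-comm c e) 1+m≤c+e))
  by-cases : Dec (D ≤ c) → MirrorTerm m e c
  by-cases (yes D≤c) = subst (MirrorTerm m e) (m∸n+n≡m D≤c) (aligned (c ∸ D) (ih (∸-monoʳ-< (s≤s z≤n) D≤c)))
  by-cases (no D≰c) = begin
    s m c ℕ.* (if ⌊ suc m ≤? c + e ⌋ then s m (c + e ∸ suc m) else 0)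
      ≡⟨ cong (s m c ℕ.*_) (if-⌊no⌋ (suc m ≤? c + e) (D≰c ∘ D≤c) _ 0) ⟩
    s m c ℕ.* 0
      ≡⟨ *-zeroʳ (s m c) ⟩
    0
      ≡⟨ sym (sumTo-zero c (λ j _ → cong (ℕ._* sq (s m j))
                                         (if-⌊no⌋ (D ≤? c ∸ j) (λ D≤c∸j → D≰c (≤-trans D≤c∸j (m∸n≤m c j))) _ 0))) ⟩
    sumTo c (λ j → coeffMirror m e (c ∸ j) ℕ.* sq (s m j)) ∎

product-step : ∀ m e c → e ≤ m →
  s m c ℕ.* s m (c + e) ≡ sumTo c (λ j → coeffPred m e (c ∸ j) ℕ.* sq (s m j)) → MirrorTerm m e c →
  s m c ℕ.* s m (c + suc e) ≡ sumTo c (λ j → coeff m e (c ∸ j) ℕ.* sq (s m j))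
product-step m e c e≤m pred-term mirror = begin
  s m c ℕ.* s m (c + suc e)
    ≡⟨ cong (λ k → s m c ℕ.* s m k) (+-suc c e) ⟩
  s m c ℕ.* s m (suc (c + e))
    ≡⟨ cong (s m c ℕ.*_) (s-suc m (c + e)) ⟩
  s m c ℕ.* (s m (c + e) + late)
    ≡⟨ *-distribˡ-+ (s m c) (s m (c + e)) late ⟩
  s m c ℕ.* s m (c + e) + s m c ℕ.* late
    ≡⟨ cong₂ _+_ pred-term mirror ⟩
  sumTo c (λ j → coeffPred m e (c ∸ j) ℕ.* sq (s m j)) + sumTo c (λ j → coeffMirror m e (c ∸ j) ℕ.* sq (s m j))
    ≡⟨ sym (sumBy-+ (λ j → coeffPred m e (c ∸ j) ℕ.* sq (s m j)) (λ j → coeffMirror m e (c ∸ j) ℕ.* sq (s m j)) (upTo (suc c))) ⟩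
  sumTo c (λ j → coeffPred m e (c ∸ j) ℕ.* sq (s m j) + coeffMirror m e (c ∸ j) ℕ.* sq (s m j))
    ≡⟨ sumBy-cong (λ j → trans (sym (*-distribʳ-+ (sq (s m j)) (coeffPred m e (c ∸ j)) _))
                               (cong (ℕ._* sq (s m j)) (sym (coeff-rec m e (c ∸ j) e≤m)))) (upTo (suc c)) ⟩
  sumTo c (λ j → coeff m e (c ∸ j) ℕ.* sq (s m j)) ∎
  where
  late : ℕ
  late = if ⌊ suc m ≤? c + e ⌋ then s m (c + e ∸ suc m) else 0

product-formula : ∀ m c → ProductFormula m c
product-formula m = <-rec (ProductFormula m) λ c ih → by-e c ih
  where
  by-e : ∀ c → (∀ {c′} → c′ < c → ProductFormula m c′) → ProductFormula m c
  by-e c ih zero    0≤m = product-step m 0 c 0≤m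
    (begin
      s m c ℕ.* s m (c + 0)                  ≡⟨ cong (λ k → s m c ℕ.* s m k) (+-identityʳ c) ⟩
      sq (s m c)                             ≡⟨ sym (*-identityˡ (sq (s m c))) ⟩
      1 ℕ.* sq (s m c)                       ≡⟨ cong (λ r → coeffPred m 0 r ℕ.* sq (s m c)) (sym (n∸n≡0 c)) ⟩
      coeffPred m 0 (c ∸ c) ℕ.* sq (s m c)   ≡⟨ sym (sumTo-last c (λ j j<c → cong (ℕ._* sq (s m j))
                                                                           (if-⌊no⌋ (c ∸ j ≟ 0) (m>n⇒m∸n≢0 j<c) _ 0))) ⟩
      sumTo c (λ j → coeffPred m 0 (c ∸ j) ℕ.* sq (s m j)) ∎)
    (mirror-term m 0 c 0≤m ih)
  by-e c ih (suc e) e<m = product-step m (suc e) c e<m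
    (by-e c ih e (≤-trans (n≤1+n e) e<m))
    (mirror-term m (suc e) c e<m ih)

-- The telescoping sum

squareTerm : ℕ → ℕ → ℕ
squareTerm m k = sq (s m k) + 2 ℕ.* sumTo k (λ i → coeff m m (k ∸ i) ℕ.* sq (s m i))

n+m+1≡n+[1+m] : ∀ n m → n + m + 1 ≡ n + suc m
n+m+1≡n+[1+m] = solve-∀

s-recurrence : ∀ m n → s m (n + m + 2) ≡ s m (n + m + 1) + s m n
s-recurrence m n = begin
  s m (n + m + 2)                                                          ≡⟨ cong (s m) (+-suc (n + m) 1) ⟩
  s m (suc (n + m + 1))                                                    ≡⟨ s-suc m (n + m + 1) ⟩
  s m (n + m + 1) + (if ⌊ suc m ≤? n + m + 1 ⌋ then s m (n + m + 1 ∸ suc m) else 0)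
    ≡⟨ cong (s m (n + m + 1) +_) (trans (if-⌊yes⌋ (suc m ≤? n + m + 1) (subst (suc m ≤_) (sym (n+m+1≡n+[1+m] n m)) (m≤n+m (suc m) n)) _ 0)
                                        (cong (s m) (trans (cong (_∸ suc m) (n+m+1≡n+[1+m] n m)) (m+n∸n≡m n (suc m))))) ⟩
  s m (n + m + 1) + s m n                                                  ∎

square-step : ∀ m n → sq (s m (n + m + 2)) ≡ sq (s m (n + m + 1)) + squareTerm m n
square-step m n = begin
  sq (s m (n + m + 2))                                              ≡⟨ cong sq (s-recurrence m n) ⟩
  sq (s m (n + m + 1) + s m n)                                      ≡⟨ square-+ (s m (n + m + 1)) (s m n) ⟩
  sq (s m (n + m + 1)) + (sq (s m n) + 2 ℕ.* (s m n ℕ.* s m (n + m + 1)))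
    ≡⟨ cong (λ k → sq (s m (n + m + 1)) + (sq (s m n) + 2 ℕ.* (s m n ℕ.* s m k))) (n+m+1≡n+[1+m] n m) ⟩
  sq (s m (n + m + 1)) + (sq (s m n) + 2 ℕ.* (s m n ℕ.* s m (n + suc m)))
    ≡⟨ cong (λ x → sq (s m (n + m + 1)) + (sq (s m n) + 2 ℕ.* x)) (product-formula m n m ≤-refl) ⟩
  sq (s m (n + m + 1)) + squareTerm m n                             ∎
  where
  square-+ : ∀ a b → (a + b) ℕ.* (a + b) ≡ a ℕ.* a + (b ℕ.* b + 2 ℕ.* (b ℕ.* a))
  square-+ = solve-∀

square-telescope : ∀ m n → sq (s m (n + m + 2)) ≡ suc (sumTo n (squareTerm m))
square-telescope m zero = begin
  sq (s m (m + 2))                        ≡⟨ square-step m 0 ⟩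
  sq (s m (m + 1)) + squareTerm m 0       ≡⟨ cong (λ x → sq x + squareTerm m 0) (s-initial m (m + 1) (≤-reflexive (+-comm m 1))) ⟩
  suc (squareTerm m 0)                    ≡⟨ cong suc (sym (+-identityʳ (squareTerm m 0))) ⟩
  suc (sumTo 0 (squareTerm m))            ∎
square-telescope m (suc n) = begin
  sq (s m (suc n + m + 2))                               ≡⟨ square-step m (suc n) ⟩
  sq (s m (suc n + m + 1)) + squareTerm m (suc n)        ≡⟨ cong (λ k → sq (s m k) + squareTerm m (suc n)) (shift m n) ⟩
  sq (s m (n + m + 2)) + squareTerm m (suc n)            ≡⟨ cong (_+ squareTerm m (suc n)) (square-telescope m n) ⟩
  suc (sumTo n (squareTerm m) + squareTerm m (suc n))    ≡⟨ cong suc (sym (sumTo-suc n (squareTerm m))) ⟩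
  suc (sumTo (suc n) (squareTerm m))                     ∎
  where
  shift : ∀ m n → suc n + m + 1 ≡ n + m + 2
  shift = solve-∀

open import Data.Integer using (+_; _-_; _*_; _^_)

+-^2 : ∀ x → (+ x) ^ 2 ≡ + sq x
+-^2 x = trans (cong (+ x *_) (ℤₚ.*-identityʳ (+ x))) (sym (ℤₚ.pos-* x x))

Σ≤-cong : ∀ n {f g : ℕ → ℤ} → (∀ k → k ≤ n → f k ≡ g k) → Σ≤ n f ≡ Σ≤ n g
Σ≤-cong n f≗g = cong (foldr ℤ._+_ (+ 0)) (map-cong-local (applyUpTo⁺₁ id (suc n) (λ k<1+n → f≗g _ (≤-pred k<1+n))))

Σ≤-+ : ∀ n (f : ℕ → ℕ) → Σ≤ n (λ k → + f k) ≡ + sumTo n f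
Σ≤-+ n f = go (upTo (suc n))
  where
  go : ∀ ks → foldr ℤ._+_ (+ 0) (map (λ k → + f k) ks) ≡ + sumBy f ks
  go []       = refl
  go (k ∷ ks) = cong (λ x → + f k ℤ.+ x) (go ks)

squareTerm-ℤ : ∀ m k → (+ s m k) ^ 2 ℤ.+ + 2 * Σ≤ k (λ i → + P (W m) (k + m + 1 ∸ i) * (+ s m i) ^ 2) ≡ + squareTerm m k
squareTerm-ℤ m k = cong₂ ℤ._+_ (+-^2 (s m k)) (trans (cong (+ 2 *_) inner) (sym (ℤₚ.pos-* 2 (sumTo k term))))
  where
  term : ℕ → ℕ
  term i = coeff m m (k ∸ i) ℕ.* sq (s m i)
  inner : Σ≤ k (λ i → + P (W m) (k + m + 1 ∸ i) * (+ s m i) ^ 2) ≡ + sumTo k term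
  inner = trans (Σ≤-cong k {g = λ i → + term i}
                         (λ i i≤k → trans (cong₂ _*_ (cong +_ (P≡coeff m k i i≤k)) (+-^2 (s m i)))
                                          (sym (ℤₚ.pos-* (coeff m m (k ∸ i)) (sq (s m i))))))
                (Σ≤-+ k term)

mainTheorem6 : (m n : ℕ) →
    (+ s m (n + m + 2)) ^ 2 - + 1
    ≡ Σ≤ n (λ k → (+ s m k) ^ 2
    Data.Integer.+ + 2 * Σ≤ k (λ i → + P (-[1+ 1 ] ∷ -[1+ 0 ] ∷ + m ∷ []) (k + m + 1 ∸ i)
    * (+ s m i) ^ 2))
mainTheorem6 m n = begin
  (+ s m (n + m + 2)) ^ 2 - + 1
    ≡⟨ cong (_- + 1) (trans (+-^2 (s m (n + m + 2))) (cong +_ (square-telescope m n))) ⟩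
  + suc total - + 1
    ≡⟨ trans ([+m]-[+n]≡m⊖n (suc total) 1) ([1+m]⊖[1+n]≡m⊖n total 0) ⟩
  + total
    ≡⟨ sym (Σ≤-+ n (squareTerm m)) ⟩
  Σ≤ n (λ k → + squareTerm m k)
    ≡⟨ Σ≤-cong n (λ k _ → sym (squareTerm-ℤ m k)) ⟩
  Σ≤ n (λ k → (+ s m k) ^ 2 Data.Integer.+ + 2 * Σ≤ k (λ i → + P (W m) (k + m + 1 ∸ i) * (+ s m i) ^ 2)) ∎
  where
  total : ℕ
  total = sumTo n (squareTerm m)
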